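{- Let $s\ge 2$ and let $f_1(x),\ldots,f_s(x)\in\mathbb{Z}[x]$ be nonzero coprime polynomials. Let $\delta$ be the smallest positive integer such that there exist $u_1(x),\ldots,u_s(x)\in\mathbb{Z}[x]$ with $u_1(x)f_1(x)+\cdots+u_s(x)f_s(x)=\delta$. For $n\in\mathbb{Z}$ let $d_n=\gcd(f_1(n),\ldots,f_s(n))$. Then every $d_n$ divides $\delta$ (so the set $\{d_n\mid n\in\mathbb{Z}\}$ is finite), and the sequence $(d_n)_{n\in\mathbb{Z}}$ is periodic of period $\delta$, i.e. $d_{n+\delta}=d_n$ for all $n\in\mathbb{Z}$.
   Context: Polynomials are coprime if their gcd in $\mathbb{Q}[x]$ is $1$ (equivalently, no common complex root); in that case a positive integer $\delta$ as described exists (Bézout identity with denominators cleared). -}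

module Defs where

open import Data.Nat as ℕ using (ℕ; zero; suc)
open import Data.Nat.GCD using (gcd)
open import Data.Integer as ℤ using (ℤ; +_; ∣_∣)
open import Data.Rational as ℚ using (ℚ)
open import Data.Fin using (Fin)
open import Data.List using (List; []; _∷_; map)
open import Data.Vec.Functional using (foldr)
open import Data.Product using (∃; Σ; _×_)
open import Relation.Binary.PropositionalEquality using (_≡_)
open import Relation.Nullary using (¬_)

-- Dense univariate polynomials as coefficient lists, lowest degree first
-- (a₀ ∷ a₁ ∷ … represents a₀ + a₁ x + …), over a coefficient type with
-- zero, addition and multiplication. Trailing zeros are allowed; equality of
-- polynomials is coefficientwise equality (see _≈P_).
module PolyOps {A : Set} (0# : A) (_+_ _*_ : A → A → A) where

  Poly : Set
  Poly = List A

  coeff : Poly → ℕ → A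
  coeff []       _       = 0#
  coeff (a ∷ p)  zero    = a
  coeff (a ∷ p)  (suc k) = coeff p k

  _≈P_ : Poly → Poly → Set
  p ≈P q = ∀ k → coeff p k ≡ coeff q k

  const : A → Poly
  const a = a ∷ []

  _+P_ : Poly → Poly → Poly
  []      +P q       = q
  (a ∷ p) +P []      = a ∷ p
  (a ∷ p) +P (b ∷ q) = (a + b) ∷ (p +P q)

  scale : A → Poly → Poly
  scale a = map (a *_)

  -- (a + x p) * q = a q + x (p q)
  _*P_ : Poly → Poly → Poly
  []      *P q = []
  (a ∷ p) *P q = scale a q +P (0# ∷ (p *P q))

  eval : Poly → A → A
  eval []      x = 0#
  eval (a ∷ p) x = a + (x * eval p x)

  ΣP : ∀ {s} → (Fin s → Poly) → Poly
  ΣP = foldr _+P_ []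

  _∣P_ : Poly → Poly → Set
  g ∣P f = ∃ λ h → (g *P h) ≈P f

  NonZeroP : Poly → Set
  NonZeroP p = ∃ λ k → ¬ (coeff p k ≡ 0#)

module ℤ[x] = PolyOps (+ 0) ℤ._+_ ℤ._*_
module ℚ[x] = PolyOps ℚ.0ℚ ℚ._+_ ℚ._*_

toℚ[x] : ℤ[x].Poly → ℚ[x].Poly
toℚ[x] = map (λ a → a ℚ./ 1)

-- The family f₁,…,f_s is coprime: its gcd in ℚ[x] is 1, i.e. every common
-- divisor in ℚ[x] of all the fᵢ is a unit (divides the constant 1).
CoprimeFamily : ∀ {s} → (Fin s → ℤ[x].Poly) → Set
CoprimeFamily {s} f =
  ∀ (g : ℚ[x].Poly) → (∀ i → g ℚ[x].∣P toℚ[x] (f i)) → g ℚ[x].∣P ℚ[x].const ℚ.1ℚ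

IsBezoutConstant : ∀ {s} → (Fin s → ℤ[x].Poly) → ℕ → Set
IsBezoutConstant {s} f δ =
  ∃ λ (u : Fin s → ℤ[x].Poly) →
    ℤ[x].ΣP (λ i → u i ℤ[x].*P f i) ℤ[x].≈P ℤ[x].const (+ δ)

-- gcd of a finite family of integers (as a natural number; gcd(∅) = 0)
gcdFam : ∀ {s} → (Fin s → ℤ) → ℕ
gcdFam a = foldr (λ x g → gcd ∣ x ∣ g) 0 a

d : ∀ {s} → (Fin s → ℤ[x].Poly) → ℤ → ℕ
d f n = gcdFam (λ i → ℤ[x].eval (f i) n)

module Submission where

-- Two facts about polynomials over ℤ carry the argument:
--   * evaluation at n is a ring homomorphism ℤ[x] → ℤ, so an identity
--     u₁f₁ + ⋯ + u_sf_s = δ in ℤ[x] gives u₁(n)f₁(n) + ⋯ + u_s(n)f_s(n) = δ,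
--     and every common divisor of the fᵢ(n) divides δ;
--   * p(n + m) ≡ p(n) (mod m) for every p ∈ ℤ[x], so a divisor k of m
--     divides p(n) iff it divides p(n + m).
-- Together with the universal property of gcdFam (it is the greatest common
-- divisor of a finite family) this gives: d_n ∣ δ for all n; hence d_n is a
-- common divisor of the fᵢ(n + δ), and d_{n+δ} one of the fᵢ(n), so the two
-- divide each other.

open import Defs
open import Data.Nat using (ℕ; _≤_; _<_)
open import Data.Nat.Divisibility using (_∣_; ∣-antisym; ∣-trans; _∣0)
open import Data.Nat.GCD using (gcd[m,n]∣m; gcd[m,n]∣n; gcd-greatest)
open import Data.Integer using (ℤ; +_; _+_; _*_; 0ℤ; ∣_∣)
open import Data.Integer.Divisibility.Signed as ℤ∣
  using (∣ᵤ⇒∣; ∣⇒∣ᵤ; ∣m∣n⇒∣m+n; ∣n⇒∣m*n; ∣m+n∣n⇒∣m)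
  renaming (_∣_ to _∣ℤ_)
open import Data.Integer.Properties using (+-identityˡ; +-identityʳ; *-zeroʳ)
open import Data.Integer.Tactic.RingSolver using (solve-∀)
open import Data.Fin using (Fin; zero; suc)
open import Data.List using ([]; _∷_)
open import Data.Product using (_×_; _,_; ∃)
open import Relation.Binary.PropositionalEquality
  using (_≡_; refl; sym; trans; cong; cong₂; subst)

open ℤ[x]

eval-+P : ∀ p q x → eval (p +P q) x ≡ eval p x + eval q x
eval-+P []      q       x = sym (+-identityˡ _)
eval-+P (a ∷ p) []      x = sym (+-identityʳ _)
eval-+P (a ∷ p) (b ∷ q) x rewrite eval-+P p q x = regroup a b x (eval p x) (eval q x)
  where
  regroup : ∀ a b x e f → a + b + x * (e + f) ≡ a + x * e + (b + x * f)
  regroup = solve-∀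

eval-scale : ∀ a q x → eval (scale a q) x ≡ a * eval q x
eval-scale a []      x = sym (*-zeroʳ a)
eval-scale a (b ∷ q) x rewrite eval-scale a q x = factor a b x (eval q x)
  where
  factor : ∀ a b x e → a * b + x * (a * e) ≡ a * (b + x * e)
  factor = solve-∀

eval-*P : ∀ p q x → eval (p *P q) x ≡ eval p x * eval q x
eval-*P []      q x = refl
eval-*P (a ∷ p) q x
  rewrite eval-+P (scale a q) (0ℤ ∷ (p *P q)) x | eval-scale a q x | eval-*P p q x
  = distribute a x (eval p x) (eval q x)
  where
  distribute : ∀ a x e f → a * f + (0ℤ + x * (e * f)) ≡ (a + x * e) * f
  distribute = solve-∀

eval-zeroP : ∀ q x → [] ≈P q → eval q x ≡ 0ℤ
eval-zeroP []      x h = refl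
eval-zeroP (b ∷ q) x h rewrite sym (h 0) | eval-zeroP q x (λ k → h (ℕ.suc k)) = vanish x
  where
  vanish : ∀ x → 0ℤ + x * 0ℤ ≡ 0ℤ
  vanish = solve-∀

eval-≈P : ∀ p q x → p ≈P q → eval p x ≡ eval q x
eval-≈P []      q       x h = sym (eval-zeroP q x h)
eval-≈P (a ∷ p) []      x h = eval-zeroP (a ∷ p) x (λ k → sym (h k))
eval-≈P (a ∷ p) (b ∷ q) x h =
  cong₂ _+_ (h 0) (cong (x *_) (eval-≈P p q x (λ k → h (ℕ.suc k))))

eval-const : ∀ a x → eval (const a) x ≡ a
eval-const a x = trans (cong (λ t → a + t) (*-zeroʳ x)) (+-identityʳ a)

∣-eval-ΣP : ∀ {s} (g : Fin s → Poly) x k →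
            (∀ i → k ∣ℤ eval (g i) x) → k ∣ℤ eval (ΣP g) x
∣-eval-ΣP {ℕ.zero}  g x k h = ℤ∣.divides 0ℤ refl
∣-eval-ΣP {ℕ.suc s} g x k h rewrite eval-+P (g zero) (ΣP (λ i → g (suc i))) x =
  ∣m∣n⇒∣m+n (h zero) (∣-eval-ΣP (λ i → g (suc i)) x k (λ i → h (suc i)))

eval-shift : ∀ p n m → ∃ λ q → eval p (n + m) ≡ eval p n + q * m
eval-shift []      n m = 0ℤ , sym (vanish m)
  where
  vanish : ∀ m → 0ℤ + 0ℤ * m ≡ 0ℤ
  vanish = solve-∀
eval-shift (a ∷ p) n m with eval-shift p n m
... | q , eq rewrite eq = eval p n + n * q + q * m , expand a n m (eval p n) q
  where
  expand : ∀ a n m e q → a + (n + m) * (e + q * m) ≡ a + n * e + (e + n * q + q * m) * m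
  expand = solve-∀

∣-eval-shift : ∀ p n m k → k ∣ℤ m → k ∣ℤ eval p n → k ∣ℤ eval p (n + m)
∣-eval-shift p n m k k∣m k∣pn with eval-shift p n m
... | q , eq = subst (k ∣ℤ_) (sym eq) (∣m∣n⇒∣m+n k∣pn (∣n⇒∣m*n q k∣m))

∣-eval-unshift : ∀ p n m k → k ∣ℤ m → k ∣ℤ eval p (n + m) → k ∣ℤ eval p n
∣-eval-unshift p n m k k∣m k∣pnm with eval-shift p n m
... | q , eq = ∣m+n∣n⇒∣m (subst (k ∣ℤ_) eq k∣pnm) (∣n⇒∣m*n q k∣m)

gcdFam-∣ : ∀ {s} (a : Fin s → ℤ) i → + gcdFam a ∣ℤ a i
gcdFam-∣ a zero    = ∣ᵤ⇒∣ (gcd[m,n]∣m ∣ a zero ∣ (gcdFam (λ j → a (suc j))))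
gcdFam-∣ a (suc i) = ∣ᵤ⇒∣ (∣-trans (gcd[m,n]∣n ∣ a zero ∣ (gcdFam (λ j → a (suc j))))
                                   (∣⇒∣ᵤ (gcdFam-∣ (λ j → a (suc j)) i)))

gcdFam-greatest : ∀ {s} (a : Fin s → ℤ) k → (∀ i → + k ∣ℤ a i) → k ∣ gcdFam a
gcdFam-greatest {ℕ.zero}  a k h = k ∣0
gcdFam-greatest {ℕ.suc s} a k h =
  gcd-greatest (∣⇒∣ᵤ (h zero)) (gcdFam-greatest (λ j → a (suc j)) k (λ i → h (suc i)))

d-∣-bezoutConstant : ∀ {s} (f : Fin s → Poly) δ → IsBezoutConstant f δ → ∀ n → d f n ∣ δ
d-∣-bezoutConstant f δ (u , combination≈δ) n =
  ∣⇒∣ᵤ (subst (+ d f n ∣ℤ_) combination[n]≡δ (∣-eval-ΣP (λ i → u i *P f i) n (+ d f n) d∣term))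
  where
  combination[n]≡δ : eval (ΣP (λ i → u i *P f i)) n ≡ + δ
  combination[n]≡δ = trans (eval-≈P (ΣP (λ i → u i *P f i)) (const (+ δ)) n combination≈δ) (eval-const (+ δ) n)

  d∣term : ∀ i → + d f n ∣ℤ eval (u i *P f i) n
  d∣term i rewrite eval-*P (u i) (f i) n =
    ∣n⇒∣m*n (eval (u i) n) (gcdFam-∣ (λ j → eval (f j) n) i)

d-∣-d-shift : ∀ {s} (f : Fin s → Poly) n m → d f n ∣ m → d f n ∣ d f (n + + m)
d-∣-d-shift f n m dₙ∣m = gcdFam-greatest _ _ λ i →
  ∣-eval-shift (f i) n (+ m) _ (∣ᵤ⇒∣ dₙ∣m) (gcdFam-∣ (λ j → eval (f j) n) i)

d-shift-∣-d : ∀ {s} (f : Fin s → Poly) n m → d f (n + + m) ∣ m → d f (n + + m) ∣ d f n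
d-shift-∣-d f n m dₙ₊ₘ∣m = gcdFam-greatest _ _ λ i →
  ∣-eval-unshift (f i) n (+ m) _ (∣ᵤ⇒∣ dₙ₊ₘ∣m) (gcdFam-∣ (λ j → eval (f j) (n + + m)) i)

proposition3p2 : (s : ℕ) → 2 ≤ s → (f : Fin s → ℤ[x].Poly) →
    (∀ i → ℤ[x].NonZeroP (f i)) → CoprimeFamily f →
    (δ : ℕ) → 0 < δ → IsBezoutConstant f δ →
    (∀ δ′ → 0 < δ′ → IsBezoutConstant f δ′ → δ ≤ δ′) →
    (∀ (n : ℤ) → d f n ∣ δ) × (∀ (n : ℤ) → d f (n + + δ) ≡ d f n)
proposition3p2 s _ f _ _ δ _ bezout _ = d∣δ , periodic
  where
  d∣δ : ∀ n → d f n ∣ δ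
  d∣δ = d-∣-bezoutConstant f δ bezout

  periodic : ∀ n → d f (n + + δ) ≡ d f n
  periodic n = ∣-antisym (d-shift-∣-d f n δ (d∣δ (n + + δ))) (d-∣-d-shift f n δ (d∣δ n))
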